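{- Let $M$ be an $n$-paving matroid on $[d]$. Then $$\dim_{\mathrm{naive}}(\Gamma_M)=nd+(n-1)|\mathcal{L}_M|-\sum_{p\in\mathcal{P}_M}\deg(p).$$
   Context: A matroid $M$ of rank $n$ is $n$-paving if every circuit has size $n$ or $n+1$. $\mathcal{P}_M$ is the set of points (ground set elements). Subspaces: circuits of size at most $n$ are grouped into classes by $C_1\sim C_2\iff\mathrm{cl}(C_1)=\mathrm{cl}(C_2)$; each class $l$ is a subspace, $\mathrm{rank}(l)$ is the rank of its circuits, $l$ is identified with the set of points lying in some circuit of the class, $|l|$ its cardinality; $\mathcal{L}_M$ is the set of subspaces. For a point $p$, $\deg(p)$ is the number of subspaces containing $p$. Naive dimension: $\dim_{\mathrm{naive}}(\Gamma_M)=nd-\sum_{l\in\mathcal{L}_M}(|l|-\mathrm{rank}(l))(n-\mathrm{rank}(l))$. -}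

module Defs where

open import Data.Nat using (ℕ; zero; suc; _≤_; _<_; _∸_; _≤?_; _<?_) renaming (_≟_ to _≟ℕ_)
open import Data.Bool using (Bool; true; false) renaming (_≟_ to _≟B_)
open import Data.Fin using (Fin)
open import Data.Fin.Subset using (Subset; _∈_; _⊆_; _∪_; _∩_; _-_; ∣_∣; ⁅_⁆; ⊤; ⋃; inside; outside)
open import Data.Fin.Subset.Properties using (_∈?_)
open import Data.Fin.Properties using (all?)
open import Data.Vec using (Vec; []; _∷_)
open import Data.Vec.Properties using (≡-dec)
open import Data.List using (List; []; _∷_; map; filter; deduplicate; length; _++_)
import Data.List as L
open import Data.Integer as ℤ using (ℤ; +_)
open import Data.Nat.ListAction renaming (sum to sumℕ)
open import Data.Product using (_×_)
open import Data.Sum using (_⊎_)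
open import Relation.Nullary using (¬_; Dec; yes; no; ¬?)
open import Relation.Nullary.Decidable using (_×-dec_; _→-dec_)
open import Relation.Binary.PropositionalEquality using (_≡_)
open import Relation.Binary using (DecidableEquality)

record Matroid (d : ℕ) : Set where
  field
    r          : Subset d → ℕ
    r-bounded  : ∀ X → r X ≤ ∣ X ∣
    r-mono     : ∀ {X Y} → X ⊆ Y → r X ≤ r Y
    r-submod   : ∀ X Y → Data.Nat._+_ (r (X ∪ Y)) (r (X ∩ Y)) ≤ Data.Nat._+_ (r X) (r Y)

module _ {d : ℕ} (M : Matroid d) where
  open Matroid M

  rankM : ℕ
  rankM = r ⊤

  Independent : Subset d → Set
  Independent X = r X ≡ ∣ X ∣

  independent? : ∀ X → Dec (Independent X)
  independent? X = r X ≟ℕ ∣ X ∣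

  IsCircuit : Subset d → Set
  IsCircuit C = (¬ Independent C) × (∀ x → x ∈ C → Independent (C - x))

  isCircuit? : ∀ C → Dec (IsCircuit C)
  isCircuit? C = ¬? (independent? C) ×-dec all? (λ x → (x ∈? C) →-dec independent? (C - x))

  cl : Subset d → Subset d
  cl X = clv (Data.Vec.allFin d)
    where
    clv : ∀ {k} → Vec (Fin d) k → Vec Bool k
    clv []       = []
    clv (x ∷ xs) with r (X ∪ ⁅ x ⁆) ≟ℕ r X
    ... | yes _ = true  ∷ clv xs
    ... | no  _ = false ∷ clv xs

allSubsets : (k : ℕ) → List (Subset k)
allSubsets zero    = [] ∷ []
allSubsets (suc k) = map (true ∷_) (allSubsets k) ++ map (false ∷_) (allSubsets k)

_≟S_ : ∀ {k} → DecidableEquality (Subset k)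
_≟S_ = ≡-dec _≟B_

record IsPaving {d : ℕ} (n : ℕ) (M : Matroid d) : Set where
  field
    rank-is-n : rankM M ≡ n
    circuit-size : ∀ C → IsCircuit M C → (∣ C ∣ ≡ n) ⊎ (∣ C ∣ ≡ suc n)

sumℤ : List ℤ → ℤ
sumℤ = L.foldr ℤ._+_ (+ 0)

module _ {d : ℕ} (M : Matroid d) where
  open Matroid M

  smallCircuits : List (Subset d)
  smallCircuits = filter (λ C → isCircuit? M C ×-dec (∣ C ∣ ≤? rankM M)) (allSubsets d)

  -- The classes of small circuits under C₁ ∼ C₂ ⇔ cl C₁ = cl C₂ are in
  -- bijection with the distinct closures; each subspace l ∈ 𝓛_M is
  -- indexed by this common closure F (no repetitions in the list).
  subspaceIndices : List (Subset d)
  subspaceIndices = deduplicate _≟S_ (map (cl M) smallCircuits)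

  classCircuits : Subset d → List (Subset d)
  classCircuits F = filter (λ C → cl M C ≟S F) smallCircuits

  points : Subset d → Subset d
  points F = ⋃ (classCircuits F)

  subspaceRank : Subset d → ℕ
  subspaceRank F with classCircuits F
  ... | []    = 0
  ... | C ∷ _ = r C

  numSubspaces : ℕ
  numSubspaces = length subspaceIndices

  deg : Fin d → ℕ
  deg p = length (filter (λ F → p ∈? points F) subspaceIndices)

  dimNaive : ℤ
  dimNaive = + (rankM M Data.Nat.* d)
             ℤ.- sumℤ (map (λ F → (+ ∣ points F ∣ ℤ.- + subspaceRank F)
                                    ℤ.* (+ rankM M ℤ.- + subspaceRank F))
                           subspaceIndices)

  sumDeg : ℕ
  sumDeg = sumℕ (map deg (L.allFin d))

-- In an n-paving matroid every circuit of size at most n has size exactly n,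
-- hence rank n − 1, so every subspace has rank n − 1 and contributes
-- (|l| − (n − 1)) · 1 to the naive dimension.  Summing, the correction term is
-- Σ_l |l| − (n − 1)|𝓛_M|, and Σ_l |l| = Σ_p deg(p) by double counting the
-- incidences between points and subspaces.
module Submission where

open import Defs
open import Data.Nat using (ℕ)
open import Data.Integer using (+_; _+_; _-_; _*_)
open import Relation.Binary.PropositionalEquality using (_≡_)

import Data.Nat as ℕ
open import Data.Nat using (suc; s≤s; _≤_; _≤?_)
open import Data.Nat.Properties using (≤-antisym; ≤∧≢⇒<; <-irrefl; n≤0⇒n≡0; +-commutativeSemigroup; module ≤-Reasoning)
open import Data.Nat.ListAction renaming (sum to sumℕ)
open import Data.Integer using (ℤ)
open import Data.Integer.Properties using (pos-*; pos-+; *-zeroʳ)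
open import Data.Integer.Tactic.RingSolver using (solve-∀)
open import Data.Bool using (true; false; if_then_else_)
open import Function using (_∘_; id)
open import Algebra.Properties.CommutativeSemigroup +-commutativeSemigroup using (interchange)
open import Data.Fin using (Fin; zero; suc)
open import Data.Fin.Subset using (Subset; _∈_; ⁅_⁆; _─_; ∣_∣; Nonempty; inside; outside)
open import Data.Fin.Subset.Properties using (_∈?_; p─⊥≡p; p─q⊆p; nonempty?; Empty-unique; ∣⊥∣≡0)
open import Data.Vec using ([]; _∷_; here; there)
open import Data.List using (List; []; _∷_; map; filter; length; allFin; tabulate)
open import Data.List.Properties using (map-tabulate; map-cong; map-cong-local)
open import Data.List.Membership.Propositional using () renaming (_∈_ to _∈ˡ_)
open import Data.List.Membership.Propositional.Properties using (∈-filter⁺; ∈-filter⁻; ∈-map⁻; ∈-deduplicate⁻)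
open import Data.List.Relation.Unary.All as All using ()
open import Data.List.Relation.Unary.Any using (here)
open import Data.Product using (∃-syntax; _×_; _,_; proj₁; proj₂)
open import Data.Sum using (inj₁; inj₂)
open import Relation.Nullary using (Dec; does; yes; no; contradiction; _×-dec_)
open import Relation.Unary using (Pred; Decidable)
open import Relation.Binary.PropositionalEquality using (refl; sym; trans; cong; cong₂; subst; module ≡-Reasoning)

∣p∣≡1+∣p-x∣ : ∀ {k} {p : Subset k} {x : Fin k} → x ∈ p → ∣ p ∣ ≡ suc ∣ p ─ ⁅ x ⁆ ∣
∣p∣≡1+∣p-x∣ {p = inside  ∷ p} here        = cong (λ q → suc ∣ q ∣) (sym (p─⊥≡p p))
∣p∣≡1+∣p-x∣ {p = inside  ∷ p} (there x∈p) = cong suc (∣p∣≡1+∣p-x∣ x∈p)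
∣p∣≡1+∣p-x∣ {p = outside ∷ p} (there x∈p) = ∣p∣≡1+∣p-x∣ x∈p

indicator : ∀ {a} {A : Set a} → Dec A → ℕ
indicator a? = if does a? then 1 else 0

length-filter-∷ : ∀ {a p} {A : Set a} {P : Pred A p} (P? : Decidable P) x xs →
                  length (filter P? (x ∷ xs)) ≡ indicator (P? x) ℕ.+ length (filter P? xs)
length-filter-∷ P? x xs with does (P? x)
... | true  = refl
... | false = refl

sum-map-+ : ∀ {a} {A : Set a} (f g : A → ℕ) xs →
            sumℕ (map (λ x → f x ℕ.+ g x) xs) ≡ sumℕ (map f xs) ℕ.+ sumℕ (map g xs)
sum-map-+ f g []       = refl
sum-map-+ f g (x ∷ xs) = trans (cong (f x ℕ.+ g x ℕ.+_) (sum-map-+ f g xs))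
                               (interchange (f x) (g x) _ _)

sum-map-0 : ∀ {a} {A : Set a} (xs : List A) → sumℕ (map (λ _ → 0) xs) ≡ 0
sum-map-0 []       = refl
sum-map-0 (_ ∷ xs) = sum-map-0 xs

sum-map-allFin-suc : ∀ {k} (f : Fin (suc k) → ℕ) →
                     sumℕ (map f (allFin (suc k))) ≡ f zero ℕ.+ sumℕ (map (f ∘ suc) (allFin k))
sum-map-allFin-suc {k} f = begin
  sumℕ (map f (allFin (suc k)))                    ≡⟨ cong sumℕ (map-tabulate id f) ⟩
  f zero ℕ.+ sumℕ (tabulate (f ∘ suc))             ≡⟨ cong (λ xs → f zero ℕ.+ sumℕ xs) (map-tabulate id (f ∘ suc)) ⟨
  f zero ℕ.+ sumℕ (map (f ∘ suc) (allFin k))       ∎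
  where open ≡-Reasoning

∣p∣≡Σ[x∈p] : ∀ {k} (p : Subset k) → sumℕ (map (λ x → indicator (x ∈? p)) (allFin k)) ≡ ∣ p ∣
∣p∣≡Σ[x∈p] []            = refl
∣p∣≡Σ[x∈p] (inside  ∷ p) = trans (sum-map-allFin-suc (λ x → indicator (x ∈? (inside ∷ p))))
                                 (cong suc (∣p∣≡Σ[x∈p] p))
∣p∣≡Σ[x∈p] (outside ∷ p) = trans (sum-map-allFin-suc (λ x → indicator (x ∈? (outside ∷ p))))
                                 (∣p∣≡Σ[x∈p] p)

double-counting : ∀ {a k} {A : Set a} (g : A → Subset k) (as : List A) →
                  sumℕ (map (λ x → length (filter (λ a → x ∈? g a) as)) (allFin k)) ≡ sumℕ (map (∣_∣ ∘ g) as)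
double-counting {k = k} g []       = sum-map-0 (allFin k)
double-counting {k = k} g (a ∷ as) = begin
  sumℕ (map (λ x → length (filter (λ a → x ∈? g a) (a ∷ as))) (allFin k))
    ≡⟨ cong sumℕ (map-cong (λ x → length-filter-∷ (λ a → x ∈? g a) a as) (allFin k)) ⟩
  sumℕ (map (λ x → indicator (x ∈? g a) ℕ.+ length (filter (λ a → x ∈? g a) as)) (allFin k))
    ≡⟨ sum-map-+ (λ x → indicator (x ∈? g a)) _ (allFin k) ⟩
  sumℕ (map (λ x → indicator (x ∈? g a)) (allFin k)) ℕ.+ sumℕ (map (λ x → length (filter (λ a → x ∈? g a) as)) (allFin k))
    ≡⟨ cong₂ ℕ._+_ (∣p∣≡Σ[x∈p] (g a)) (double-counting g as) ⟩
  ∣ g a ∣ ℕ.+ sumℕ (map (∣_∣ ∘ g) as)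
    ∎
  where open ≡-Reasoning

sumℤ-map-cong : ∀ {a} {A : Set a} {f g : A → ℤ} {xs : List A} →
                (∀ {x} → x ∈ˡ xs → f x ≡ g x) → sumℤ (map f xs) ≡ sumℤ (map g xs)
sumℤ-map-cong f≡g = cong sumℤ (map-cong-local (All.tabulate f≡g))

sumℤ-map-shift : ∀ {a} {A : Set a} (f : A → ℕ) (c : ℤ) (xs : List A) →
                 sumℤ (map (λ x → + f x - c) xs) ≡ + sumℕ (map f xs) - c * + length xs
sumℤ-map-shift f c []       = sym (cong (λ t → + 0 - t) (*-zeroʳ c))
sumℤ-map-shift f c (x ∷ xs) = begin
  (+ f x - c) + sumℤ (map (λ x → + f x - c) xs)      ≡⟨ cong (λ t → (+ f x - c) + t) (sumℤ-map-shift f c xs) ⟩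
  (+ f x - c) + (+ sumℕ (map f xs) - c * + length xs) ≡⟨ regroup (+ f x) (+ sumℕ (map f xs)) c (+ length xs) ⟩
  (+ f x + + sumℕ (map f xs)) - c * (+ 1 + + length xs) ≡⟨ cong (_- c * + suc (length xs)) (pos-+ (f x) _) ⟨
  + sumℕ (map f (x ∷ xs)) - c * + length (x ∷ xs)    ∎
  where
  open ≡-Reasoning
  regroup : ∀ a s c l → (a - c) + (s - c * l) ≡ (a + s) - c * (+ 1 + l)
  regroup = solve-∀

module _ {d : ℕ} (M : Matroid d) where
  open Matroid M

  circuit-nonempty : ∀ {C} → IsCircuit M C → Nonempty C
  circuit-nonempty {C} (dependent , _) with nonempty? C
  ... | yes ne = ne
  ... | no empty = contradiction independent dependent
    where
    ∣C∣≡0 : ∣ C ∣ ≡ 0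
    ∣C∣≡0 = trans (cong ∣_∣ (Empty-unique empty)) (∣⊥∣≡0 d)
    independent : Independent M C
    independent = trans (n≤0⇒n≡0 (subst (r C ≤_) ∣C∣≡0 (r-bounded C))) (sym ∣C∣≡0)

  -- Deleting a point of a circuit leaves an independent set, so r C ≥ |C| − 1.
  circuit-rank : ∀ {C} → IsCircuit M C → suc (r C) ≡ ∣ C ∣
  circuit-rank {C} circuit@(dependent , minimal) with circuit-nonempty circuit
  ... | x , x∈C = ≤-antisym (≤∧≢⇒< (r-bounded C) dependent) (begin
    ∣ C ∣               ≡⟨ ∣p∣≡1+∣p-x∣ x∈C ⟩
    suc ∣ C ─ ⁅ x ⁆ ∣   ≡⟨ cong suc (minimal x x∈C) ⟨
    suc (r (C ─ ⁅ x ⁆)) ≤⟨ s≤s (r-mono (p─q⊆p C _)) ⟩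
    suc (r C)           ∎)
    where open ≤-Reasoning

  smallCircuit⁻ : ∀ {C} → C ∈ˡ smallCircuits M → IsCircuit M C × ∣ C ∣ ≤ rankM M
  smallCircuit⁻ C∈ = proj₂ (∈-filter⁻ (λ C → isCircuit? M C ×-dec (∣ C ∣ ≤? rankM M)) {xs = allSubsets d} C∈)

  classCircuit⁻ : ∀ {F C} → C ∈ˡ classCircuits M F → C ∈ˡ smallCircuits M
  classCircuit⁻ {F} C∈ = proj₁ (∈-filter⁻ (λ C → cl M C ≟S F) {xs = smallCircuits M} C∈)

  subspaceIndex⁻ : ∀ {F} → F ∈ˡ subspaceIndices M → ∃[ C ] C ∈ˡ classCircuits M F
  subspaceIndex⁻ F∈ with ∈-map⁻ (cl M) (∈-deduplicate⁻ _≟S_ (map (cl M) (smallCircuits M)) F∈)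
  ... | C , C∈ , refl = C , ∈-filter⁺ (λ C′ → cl M C′ ≟S cl M C) C∈ refl

  subspaceRank-witness : ∀ {F C} → C ∈ˡ classCircuits M F →
                         ∃[ C′ ] C′ ∈ˡ smallCircuits M × subspaceRank M F ≡ r C′
  subspaceRank-witness {F} C∈ with classCircuits M F in eq
  subspaceRank-witness () | []
  ... | C′ ∷ _ = C′ , classCircuit⁻ (subst (C′ ∈ˡ_) (sym eq) (here refl)) , refl

module _ {n d : ℕ} {M : Matroid d} (paving : IsPaving n M) where
  open Matroid M
  open IsPaving paving

  smallCircuit-size : ∀ {C} → C ∈ˡ smallCircuits M → ∣ C ∣ ≡ n
  smallCircuit-size {C} C∈ with smallCircuit⁻ M C∈
  ... | circuit , ∣C∣≤rank with circuit-size C circuit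
  ...   | inj₁ ∣C∣≡n   = ∣C∣≡n
  ...   | inj₂ ∣C∣≡1+n = contradiction (subst (_≤ n) ∣C∣≡1+n (subst (∣ C ∣ ≤_) rank-is-n ∣C∣≤rank))
                                         (<-irrefl refl)

  smallCircuit-rank : ∀ {C} → C ∈ˡ smallCircuits M → suc (r C) ≡ n
  smallCircuit-rank C∈ = trans (circuit-rank M (proj₁ (smallCircuit⁻ M C∈))) (smallCircuit-size C∈)

  subspaceRank-paving : ∀ {F} → F ∈ˡ subspaceIndices M → suc (subspaceRank M F) ≡ n
  subspaceRank-paving F∈ with subspaceRank-witness M (proj₂ (subspaceIndex⁻ M F∈))
  ... | C , C∈ , rank≡ = trans (cong suc rank≡) (smallCircuit-rank C∈)

  subspace-term : ∀ {F} → F ∈ˡ subspaceIndices M →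
                  (+ ∣ points M F ∣ - + subspaceRank M F) * (+ rankM M - + subspaceRank M F)
                    ≡ + ∣ points M F ∣ - (+ n - + 1)
  subspace-term {F} F∈ = begin
    (l - + s) * (+ rankM M - + s)   ≡⟨ cong (λ k → (l - + s) * (+ k - + s)) (trans rank-is-n (sym 1+s≡n)) ⟩
    (l - + s) * (+ suc s - + s)     ≡⟨ unit-factor l (+ s) ⟩
    l - (+ suc s - + 1)             ≡⟨ cong (λ k → l - (+ k - + 1)) 1+s≡n ⟩
    l - (+ n - + 1)                 ∎
    where
    open ≡-Reasoning
    l : ℤ
    l = + ∣ points M F ∣
    s : ℕ
    s = subspaceRank M F
    1+s≡n : suc s ≡ n
    1+s≡n = subspaceRank-paving F∈
    unit-factor : ∀ a s → (a - s) * ((+ 1 + s) - s) ≡ a - ((+ 1 + s) - + 1)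
    unit-factor = solve-∀

lemma3p5 : (n d : ℕ) (M : Matroid d) → IsPaving n M →
    dimNaive M ≡ (+ n * + d) + ((+ n - + 1) * + numSubspaces M) - + sumDeg M
lemma3p5 n d M paving = begin
  dimNaive M
    ≡⟨ cong₂ _-_ (trans (cong (λ k → + (k ℕ.* d)) (IsPaving.rank-is-n paving)) (pos-* n d))
                 (sumℤ-map-cong (subspace-term paving)) ⟩
  + n * + d - sumℤ (map (λ F → + ∣ points M F ∣ - c) (subspaceIndices M))
    ≡⟨ cong (+ n * + d -_) (sumℤ-map-shift (∣_∣ ∘ points M) c (subspaceIndices M)) ⟩
  + n * + d - (+ Σ∣l∣ - c * + numSubspaces M)
    ≡⟨ regroup (+ n * + d) (+ Σ∣l∣) c (+ numSubspaces M) ⟩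
  + n * + d + c * + numSubspaces M - + Σ∣l∣
    ≡⟨ cong (λ s → + n * + d + c * + numSubspaces M - + s) (double-counting (points M) (subspaceIndices M)) ⟨
  + n * + d + c * + numSubspaces M - + sumDeg M
    ∎
  where
  open ≡-Reasoning
  c : ℤ
  c = + n - + 1
  Σ∣l∣ : ℕ
  Σ∣l∣ = sumℕ (map (∣_∣ ∘ points M) (subspaceIndices M))
  regroup : ∀ x s c l → x - (s - c * l) ≡ x + c * l - s
  regroup = solve-∀
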